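{- Let $n\ge 1$. Every extended visual cryptography scheme with $n$ transparencies (i.e. an $\mathfrak S$-extended visual cryptography scheme with $\mathfrak S=\mathcal P(\{1,\dots,n\})\setminus\{\emptyset\}$) in which every image has positive contrast, i.e. $l_T<h_T$ for all nonempty $T\subseteq\{1,\dots,n\}$, has pixel expansion $m\ge \frac12(3^n-1)$. Consequently Droste's construction, whose pixel expansion is $\sum_{\emptyset\neq T\subseteq\{1,\dots,n\}}2^{|T|-1}=\frac12(3^n-1)$, has minimal pixel expansion among such schemes.
   Context: Let $\mathfrak S\subseteq\mathcal P(\{1,\dots,n\})\setminus\{\emptyset\}$ be nonempty. An $\mathfrak S$-extended visual cryptography scheme with $n$ transparencies and pixel expansion $m$ consists of integers $0\le l_T\le h_T\le m$ for $T\in\mathfrak S$, together with, for every $\mathfrak T\subseteq\mathfrak S$, a nonempty multiset $C^{\mathfrak T}$ of $n\times m$ Boolean matrices (row $i$ gives the colours of the $m$ subpixels on transparency $i$; $C^{\mathfrak T}$ is used to encode a pixel which is black exactly in the images $I_T$, $T\in\mathfrak T$), such that: (1) for every $B\in C^{\mathfrak T}$ and every $\{i_1,\dots,i_q\}\in\mathfrak S$, the Hamming weight of the Boolean OR of rows $i_1,\dots,i_q$ of $B$ equals $h_{\{i_1,\dots,i_q\}}$ if $\{i_1,\dots,i_q\}\in\mathfrak T$ and $l_{\{i_1,\dots,i_q\}}$ otherwise; (2) for every $Q\subseteq\{1,\dots,n\}$ and all $\mathfrak T,\mathfrak T'\subseteq\mathfrak S$ with $\mathfrak T\cap\mathcal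 P(Q)=\mathfrak T'\cap\mathcal P(Q)$, restricting the matrices of $C^{\mathfrak T}$ and of $C^{\mathfrak T'}$ to the rows indexed by $Q$ yields the same multiset. When $\mathfrak S=\mathcal P(\{1,\dots,n\})\setminus\{\emptyset\}$ it is called an extended visual cryptography scheme. Droste's construction: for each $T\in\mathfrak S$ one uses $2^{|T|-1}$ subpixels forming a $(|T|,|T|)$-threshold visual cryptography scheme among the transparencies in $T$, these subpixels being always black on transparencies $i\notin T$; the total pixel expansion is $\sum_{T\in\mathfrak S}2^{|T|-1}$ and every image has $h_T-l_T=1$. -}

module Defs where

open import Data.Bool using (Bool; true; false; _∨_; if_then_else_)
open import Data.Nat using (ℕ; zero; suc; _≤_; _+_; _^_)
open import Data.Vec using (Vec; []; _∷_; replicate; zipWith)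
open import Data.List using (List; map; _++_; [_])
open import Data.Nat.ListAction using (sum)
import Data.List as L
open import Data.Fin.Subset using (Subset; Nonempty; _⊆_; ∣_∣)
open import Data.List.Membership.Propositional using (_∈_)
open import Data.List.Relation.Binary.Permutation.Propositional using (_↭_)
open import Relation.Binary.PropositionalEquality using (_≡_; _≢_)

-- An n × m Boolean matrix: n rows (transparencies), m columns (subpixels).
-- true = black subpixel.
Matrix : ℕ → ℕ → Set
Matrix n m = Vec (Vec Bool m) n

weight : ∀ {m} → Vec Bool m → ℕ
weight [] = 0
weight (true ∷ v) = suc (weight v)
weight (false ∷ v) = weight v

orRows : ∀ {n m} → Subset n → Matrix n m → Vec Bool m
orRows [] [] = replicate _ false
orRows (true ∷ T) (r ∷ B) = zipWith _∨_ r (orRows T B)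
orRows (false ∷ T) (r ∷ B) = orRows T B

restrict : ∀ {n m} → Subset n → Matrix n m → List (Vec Bool m)
restrict [] [] = L.[]
restrict (true ∷ Q) (r ∷ B) = r L.∷ restrict Q B
restrict (false ∷ Q) (r ∷ B) = restrict Q B

-- A family 𝔗 ⊆ 𝔖 of subsets is given by its characteristic function;
-- its values outside 𝔖 are irrelevant (never inspected by the axioms).
Family : ℕ → Set
Family n = Subset n → Bool

-- 𝔖-extended visual cryptography scheme with n transparencies and
-- pixel expansion m.  Multisets of matrices are lists up to permutation.
record SEVCS (n : ℕ) (𝔖 : Subset n → Set) (m : ℕ) : Set where
  field
    l h : Subset n → ℕ
    l≤h : ∀ T → 𝔖 T → l T ≤ h T
    h≤m : ∀ T → 𝔖 T → h T ≤ m
    C : Family n → List (Matrix n m)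
    C-nonempty : ∀ 𝔗 → C 𝔗 ≢ L.[]
    contrast : ∀ 𝔗 B → B ∈ C 𝔗 → ∀ T → 𝔖 T →
      weight (orRows T B) ≡ (if 𝔗 T then h T else l T)
    security : ∀ (Q : Subset n) (𝔗 𝔗′ : Family n) →
      (∀ T → 𝔖 T → T ⊆ Q → 𝔗 T ≡ 𝔗′ T) →
      map (restrict Q) (C 𝔗) ↭ map (restrict Q) (C 𝔗′)

EVCS : ℕ → ℕ → Set
EVCS n m = SEVCS n Nonempty m

allSubsets : ∀ n → List (Subset n)
allSubsets zero = [ [] ]
allSubsets (suc n) = map (false ∷_) (allSubsets n) ++ map (true ∷_) (allSubsets n)

drosteTerm : ∀ {n} → Subset n → ℕ
drosteTerm T with ∣ T ∣
... | zero = 0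
... | suc k = 2 ^ k

drosteExpansion : ℕ → ℕ
drosteExpansion n = sum (map drosteTerm (allSubsets n))

-- Fix W ⊆ {1,…,n} and a matrix B encoding the family 𝔗_W of all T ⊇ W with
-- |T ─ W| even.  A column of B is white on T exactly when T avoids its black
-- rows, so by inclusion–exclusion every column is white on at least as many
-- such T with |T ─ W| even as with |T ─ W| odd.  As B has m − h_T white
-- columns on T ∈ 𝔗_W and m − l_T on the other T ⊇ W, this gives
--   Σ_{T ⊇ W, |T ─ W| even} (m − h_T) ≥ Σ_{T ⊇ W, |T ─ W| odd} (m − l_T),
-- where the term T = ∅ (present only for W = ∅) counts m.  Summed over all W,
-- every nonempty T occurs 2^(|T|−1) times on each side, so
-- m ≥ Σ_{T ≠ ∅} 2^(|T|−1) (h_T − l_T), which is at least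
-- Σ_{T ≠ ∅} 2^(|T|−1) = (3^n − 1)/2 when all contrasts are positive.
module Submission where

open import Defs
open import Data.Bool using (Bool; true; false; _∨_; if_then_else_)
open import Data.Fin using (zero)
open import Data.Fin.Subset using (Subset; Nonempty; Empty; ⊥; ∣_∣; inside; outside)
open import Data.Fin.Subset.Properties using (nonempty?; drop-∷-Empty; ∉⊥)
open import Data.List using (List; []; _∷_; _++_)
import Data.List as List
open import Data.List.Membership.Propositional using (_∈_)
open import Data.List.Properties using (map-++; map-∘)
import Data.List.Relation.Unary.Any as Any
open import Data.Nat using (ℕ; zero; suc; _≤_; _<_; _+_; _*_; _^_; _∸_; z≤n)
open import Data.Nat.ListAction using (sum)
open import Data.Nat.ListAction.Properties using (sum-++)
open import Data.Nat.Properties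
open import Algebra.Properties.CommutativeSemigroup +-commutativeSemigroup
  using (interchange; xy∙z≈x∙zy)
import Data.Nat.Solver as NatSolver
open import Data.Parity.Base using (Parity; 0ℙ; 1ℙ; _⁻¹)
open import Data.Product using (_×_; _,_; proj₁; proj₂; ∃)
open import Data.Vec using (Vec; []; _∷_; head; tail; replicate; here)
import Data.Vec as Vec
open import Relation.Nullary using (yes; no; contradiction)
open import Relation.Binary.PropositionalEquality
  using (_≡_; _≢_; refl; sym; trans; cong; cong₂; subst₂; module ≡-Reasoning)

open NatSolver.+-*-Solver using (solve; _:+_; _:*_; con; _:=_)

∑ : ∀ {n} → (Subset n → ℕ) → ℕ
∑ {zero} f = f []
∑ {suc n} f = ∑ (λ T → f (outside ∷ T)) + ∑ (λ T → f (inside ∷ T))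

∑-cong : ∀ {n} {f g : Subset n → ℕ} → (∀ T → f T ≡ g T) → ∑ f ≡ ∑ g
∑-cong {zero} f≡g = f≡g []
∑-cong {suc n} f≡g =
  cong₂ _+_ (∑-cong (λ T → f≡g (outside ∷ T))) (∑-cong (λ T → f≡g (inside ∷ T)))

∑-mono-≤ : ∀ {n} {f g : Subset n → ℕ} → (∀ T → f T ≤ g T) → ∑ f ≤ ∑ g
∑-mono-≤ {zero} f≤g = f≤g []
∑-mono-≤ {suc n} f≤g =
  +-mono-≤ (∑-mono-≤ (λ T → f≤g (outside ∷ T))) (∑-mono-≤ (λ T → f≤g (inside ∷ T)))

∑-distrib-+ : ∀ {n} (f g : Subset n → ℕ) → ∑ (λ T → f T + g T) ≡ ∑ f + ∑ g
∑-distrib-+ {zero} f g = refl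
∑-distrib-+ {suc n} f g = begin
  ∑ (λ T → f₀ T + g₀ T) + ∑ (λ T → f₁ T + g₁ T)
    ≡⟨ cong₂ _+_ (∑-distrib-+ f₀ g₀) (∑-distrib-+ f₁ g₁) ⟩
  (∑ f₀ + ∑ g₀) + (∑ f₁ + ∑ g₁)
    ≡⟨ interchange (∑ f₀) (∑ g₀) (∑ f₁) (∑ g₁) ⟩
  (∑ f₀ + ∑ f₁) + (∑ g₀ + ∑ g₁) ∎
  where
  open ≡-Reasoning
  f₀ f₁ g₀ g₁ : Subset n → ℕ
  f₀ T = f (outside ∷ T)
  f₁ T = f (inside ∷ T)
  g₀ T = g (outside ∷ T)
  g₁ T = g (inside ∷ T)

∑≡sum-allSubsets : ∀ n (f : Subset n → ℕ) → ∑ f ≡ sum (List.map f (allSubsets n))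
∑≡sum-allSubsets zero f = sym (+-identityʳ (f []))
∑≡sum-allSubsets (suc n) f = begin
  ∑ (λ T → f (outside ∷ T)) + ∑ (λ T → f (inside ∷ T))
    ≡⟨ cong₂ _+_ (∑≡sum-allSubsets n _) (∑≡sum-allSubsets n _) ⟩
  sum (List.map (λ T → f (outside ∷ T)) subsets) + sum (List.map (λ T → f (inside ∷ T)) subsets)
    ≡⟨ cong₂ (λ xs ys → sum xs + sum ys) (map-∘ subsets) (map-∘ subsets) ⟩
  sum (List.map f outsides) + sum (List.map f insides)
    ≡⟨ sym (sum-++ (List.map f outsides) _) ⟩
  sum (List.map f outsides ++ List.map f insides)
    ≡⟨ cong sum (sym (map-++ f outsides insides)) ⟩
  sum (List.map f (outsides ++ insides)) ∎
  where
  open ≡-Reasoning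
  subsets = allSubsets n
  outsides = List.map (outside ∷_) subsets
  insides = List.map (inside ∷_) subsets

-- T ⊇[ p ]ᵇ W : W ⊆ T and |T ─ W| has parity p.
infix 5 _⊇[_]ᵇ_

_⊇[_]ᵇ_ : ∀ {n} → Subset n → Parity → Subset n → Bool
(inside ∷ T) ⊇[ p ]ᵇ (inside ∷ W) = T ⊇[ p ]ᵇ W
(outside ∷ T) ⊇[ p ]ᵇ (inside ∷ W) = false
(outside ∷ T) ⊇[ p ]ᵇ (outside ∷ W) = T ⊇[ p ]ᵇ W
(inside ∷ T) ⊇[ p ]ᵇ (outside ∷ W) = T ⊇[ p ⁻¹ ]ᵇ W
[] ⊇[ 0ℙ ]ᵇ [] = true
[] ⊇[ 1ℙ ]ᵇ [] = false

⊇ᵇ-⁻¹-disjoint : ∀ {n} p (T W : Subset n) →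
  T ⊇[ p ]ᵇ W ≡ true → T ⊇[ p ⁻¹ ]ᵇ W ≡ false
⊇ᵇ-⁻¹-disjoint 0ℙ [] [] _ = refl
⊇ᵇ-⁻¹-disjoint 1ℙ [] [] ()
⊇ᵇ-⁻¹-disjoint p (outside ∷ T) (inside ∷ W) ()
⊇ᵇ-⁻¹-disjoint p (inside ∷ T) (inside ∷ W) = ⊇ᵇ-⁻¹-disjoint p T W
⊇ᵇ-⁻¹-disjoint p (outside ∷ T) (outside ∷ W) = ⊇ᵇ-⁻¹-disjoint p T W
⊇ᵇ-⁻¹-disjoint p (inside ∷ T) (outside ∷ W) = ⊇ᵇ-⁻¹-disjoint (p ⁻¹) T W

supersetSum : ∀ {n} → Parity → (Subset n → ℕ) → Subset n → ℕ
supersetSum p f (inside ∷ W) = supersetSum p (λ T → f (inside ∷ T)) W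
supersetSum p f (outside ∷ W) =
  supersetSum p (λ T → f (outside ∷ T)) W + supersetSum (p ⁻¹) (λ T → f (inside ∷ T)) W
supersetSum 0ℙ f [] = f []
supersetSum 1ℙ f [] = 0

supersetSum-cong : ∀ {n} p (W : Subset n) {f g : Subset n → ℕ} →
  (∀ T → T ⊇[ p ]ᵇ W ≡ true → f T ≡ g T) → supersetSum p f W ≡ supersetSum p g W
supersetSum-cong 0ℙ [] f≡g = f≡g [] refl
supersetSum-cong 1ℙ [] f≡g = refl
supersetSum-cong p (inside ∷ W) f≡g = supersetSum-cong p W (λ T → f≡g (inside ∷ T))
supersetSum-cong p (outside ∷ W) f≡g = cong₂ _+_
  (supersetSum-cong p W (λ T → f≡g (outside ∷ T)))
  (supersetSum-cong (p ⁻¹) W (λ T → f≡g (inside ∷ T)))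

supersetSum-0 : ∀ {n} p (W : Subset n) → supersetSum p (λ _ → 0) W ≡ 0
supersetSum-0 0ℙ [] = refl
supersetSum-0 1ℙ [] = refl
supersetSum-0 p (inside ∷ W) = supersetSum-0 p W
supersetSum-0 p (outside ∷ W) = cong₂ _+_ (supersetSum-0 p W) (supersetSum-0 (p ⁻¹) W)

supersetSum-distrib-+ : ∀ {n} p (W : Subset n) (f g : Subset n → ℕ) →
  supersetSum p (λ T → f T + g T) W ≡ supersetSum p f W + supersetSum p g W
supersetSum-distrib-+ 0ℙ [] f g = refl
supersetSum-distrib-+ 1ℙ [] f g = refl
supersetSum-distrib-+ p (inside ∷ W) f g = supersetSum-distrib-+ p W _ _
supersetSum-distrib-+ p (outside ∷ W) f g = trans
  (cong₂ _+_ (supersetSum-distrib-+ p W f₀ g₀) (supersetSum-distrib-+ (p ⁻¹) W f₁ g₁))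
  (interchange
    (supersetSum p f₀ W) (supersetSum p g₀ W) (supersetSum (p ⁻¹) f₁ W) (supersetSum (p ⁻¹) g₁ W))
  where
  f₀ f₁ g₀ g₁ : Subset _ → ℕ
  f₀ T = f (outside ∷ T)
  f₁ T = f (inside ∷ T)
  g₀ T = g (outside ∷ T)
  g₁ T = g (inside ∷ T)

subsetCount : ∀ {n} → Parity → Subset n → ℕ
subsetCount p (outside ∷ T) = subsetCount p T
subsetCount p (inside ∷ T) = subsetCount p T + subsetCount (p ⁻¹) T
subsetCount 0ℙ [] = 1
subsetCount 1ℙ [] = 0

∑-supersetSum : ∀ {n} p (f : Subset n → ℕ) →
  ∑ (supersetSum p f) ≡ ∑ (λ T → subsetCount p T * f T)
∑-supersetSum {zero} 0ℙ f = sym (+-identityʳ (f []))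
∑-supersetSum {zero} 1ℙ f = refl
∑-supersetSum {suc n} p f = begin
  ∑ (λ W → supersetSum p f₀ W + supersetSum (p ⁻¹) f₁ W) + ∑ (supersetSum p f₁)
    ≡⟨ cong (_+ ∑ (supersetSum p f₁)) (∑-distrib-+ (supersetSum p f₀) (supersetSum (p ⁻¹) f₁)) ⟩
  (∑ (supersetSum p f₀) + ∑ (supersetSum (p ⁻¹) f₁)) + ∑ (supersetSum p f₁)
    ≡⟨ cong₂ _+_ (cong₂ _+_ (∑-supersetSum p f₀) (∑-supersetSum (p ⁻¹) f₁))
                 (∑-supersetSum p f₁) ⟩
  (∑ (λ T → c p T * f₀ T) + ∑ (c⁻¹f₁)) + ∑ (cf₁)
    ≡⟨ xy∙z≈x∙zy (∑ (λ T → c p T * f₀ T)) (∑ (c⁻¹f₁)) (∑ (cf₁)) ⟩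
  ∑ (λ T → c p T * f₀ T) + (∑ (cf₁) + ∑ (c⁻¹f₁))
    ≡⟨ cong (∑ (λ T → c p T * f₀ T) +_) (sym (∑-distrib-+ cf₁ c⁻¹f₁)) ⟩
  ∑ (λ T → c p T * f₀ T) + ∑ (λ T → c p T * f₁ T + c (p ⁻¹) T * f₁ T)
    ≡⟨ cong (∑ (λ T → c p T * f₀ T) +_)
            (∑-cong (λ T → sym (*-distribʳ-+ (f₁ T) (c p T) (c (p ⁻¹) T)))) ⟩
  ∑ (λ T → c p T * f₀ T) + ∑ (λ T → (c p T + c (p ⁻¹) T) * f₁ T) ∎
  where
  open ≡-Reasoning
  c = subsetCount
  f₀ f₁ cf₁ c⁻¹f₁ : Subset n → ℕ
  f₀ T = f (outside ∷ T)
  f₁ T = f (inside ∷ T)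
  cf₁ T = c p T * f₁ T
  c⁻¹f₁ T = c (p ⁻¹) T * f₁ T

subsetCount-1ℙ-Empty : ∀ {n} {T : Subset n} → Empty T → subsetCount 1ℙ T ≡ 0
subsetCount-1ℙ-Empty {T = []} _ = refl
subsetCount-1ℙ-Empty {T = inside ∷ T} T-empty = contradiction (zero , here) T-empty
subsetCount-1ℙ-Empty {T = outside ∷ T} T-empty = subsetCount-1ℙ-Empty (drop-∷-Empty T-empty)

-- Σ_{W ⊆ T} (−1)^|T ─ W| is 1 for T = ∅ and 0 otherwise.
∑-subsetCount-alternating : ∀ {n} (f : Subset n → ℕ) →
  ∑ (λ T → subsetCount 0ℙ T * f T) ≡ f ⊥ + ∑ (λ T → subsetCount 1ℙ T * f T)
∑-subsetCount-alternating {zero} f = refl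
∑-subsetCount-alternating {suc n} f = begin
  ∑ (λ T → c₀ T * f₀ T) + ∑ (λ T → (c₀ T + c₁ T) * f₁ T)
    ≡⟨ cong₂ _+_ (∑-subsetCount-alternating f₀)
                 (∑-cong (λ T → cong (_* f₁ T) (+-comm (c₀ T) (c₁ T)))) ⟩
  f ⊥ + ∑ (λ T → c₁ T * f₀ T) + ∑ (λ T → (c₁ T + c₀ T) * f₁ T)
    ≡⟨ +-assoc (f ⊥) _ _ ⟩
  f ⊥ + (∑ (λ T → c₁ T * f₀ T) + ∑ (λ T → (c₁ T + c₀ T) * f₁ T)) ∎
  where
  open ≡-Reasoning
  c₀ c₁ f₀ f₁ : Subset n → ℕ
  c₀ = subsetCount 0ℙ
  c₁ = subsetCount 1ℙ
  f₀ T = f (outside ∷ T)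
  f₁ T = f (inside ∷ T)

subsetCount-1ℙ+0ℙ≡2^∣T∣ : ∀ {n} (T : Subset n) → subsetCount 1ℙ T + subsetCount 0ℙ T ≡ 2 ^ ∣ T ∣
subsetCount-1ℙ+0ℙ≡2^∣T∣ [] = refl
subsetCount-1ℙ+0ℙ≡2^∣T∣ (outside ∷ T) = subsetCount-1ℙ+0ℙ≡2^∣T∣ T
subsetCount-1ℙ+0ℙ≡2^∣T∣ (inside ∷ T) = begin
  (c₁ + c₀) + (c₀ + c₁)          ≡⟨ cong ((c₁ + c₀) +_) (+-comm c₀ c₁) ⟩
  (c₁ + c₀) + (c₁ + c₀)          ≡⟨ cong₂ _+_ c₁+c₀≡2^∣T∣ (trans c₁+c₀≡2^∣T∣ (sym (+-identityʳ _))) ⟩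
  2 ^ ∣ T ∣ + (2 ^ ∣ T ∣ + 0)    ∎
  where
  open ≡-Reasoning
  c₀ c₁ : ℕ
  c₀ = subsetCount 0ℙ T
  c₁ = subsetCount 1ℙ T
  c₁+c₀≡2^∣T∣ : c₁ + c₀ ≡ 2 ^ ∣ T ∣
  c₁+c₀≡2^∣T∣ = subsetCount-1ℙ+0ℙ≡2^∣T∣ T

subsetCount-1ℙ≡drosteTerm : ∀ {n} (T : Subset n) → subsetCount 1ℙ T ≡ drosteTerm T
subsetCount-1ℙ≡drosteTerm [] = refl
subsetCount-1ℙ≡drosteTerm (outside ∷ T) = subsetCount-1ℙ≡drosteTerm T
subsetCount-1ℙ≡drosteTerm (inside ∷ T) = subsetCount-1ℙ+0ℙ≡2^∣T∣ T

drosteExpansion≡∑ : ∀ n → drosteExpansion n ≡ ∑ (subsetCount {n} 1ℙ)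
drosteExpansion≡∑ n = trans
  (sym (∑≡sum-allSubsets n drosteTerm))
  (∑-cong {n} (λ T → sym (subsetCount-1ℙ≡drosteTerm T)))

2*∑-subsetCount-1ℙ+1≡3^n : ∀ n → 2 * ∑ (subsetCount {n} 1ℙ) + 1 ≡ 3 ^ n
2*∑-subsetCount-1ℙ+1≡3^n zero = refl
2*∑-subsetCount-1ℙ+1≡3^n (suc n) = begin
  2 * (o + ∑ {n} (λ T → subsetCount 1ℙ T + subsetCount 0ℙ T)) + 1
    ≡⟨ cong (λ x → 2 * (o + x) + 1) (∑-distrib-+ {n} (subsetCount 1ℙ) (subsetCount 0ℙ)) ⟩
  2 * (o + (o + e)) + 1           ≡⟨ cong (λ x → 2 * (o + (o + x)) + 1) e≡1+o ⟩
  2 * (o + (o + (1 + o))) + 1     ≡⟨ arithmetic o ⟩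
  3 * (2 * o + 1)                 ≡⟨ cong (3 *_) (2*∑-subsetCount-1ℙ+1≡3^n n) ⟩
  3 * 3 ^ n ∎
  where
  open ≡-Reasoning
  o e : ℕ
  o = ∑ (subsetCount {n} 1ℙ)
  e = ∑ (subsetCount {n} 0ℙ)
  e≡1+o : e ≡ 1 + o
  e≡1+o = begin
    e                                       ≡⟨ ∑-cong {n} (λ T → sym (*-identityʳ _)) ⟩
    ∑ {n} (λ T → subsetCount 0ℙ T * 1)       ≡⟨ ∑-subsetCount-alternating {n} (λ _ → 1) ⟩
    1 + ∑ {n} (λ T → subsetCount 1ℙ T * 1)   ≡⟨ cong (1 +_) (∑-cong {n} (λ T → *-identityʳ _)) ⟩
    1 + o ∎
  arithmetic : ∀ x → 2 * (x + (x + (1 + x))) + 1 ≡ 3 * (2 * x + 1)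
  arithmetic = solve 1
    (λ x → con 2 :* (x :+ (x :+ (con 1 :+ x))) :+ con 1 := con 3 :* (con 2 :* x :+ con 1))
    refl

2*drosteExpansion+1≡3^n : ∀ n → 2 * drosteExpansion n + 1 ≡ 3 ^ n
2*drosteExpansion+1≡3^n n =
  trans (cong (λ x → 2 * x + 1) (drosteExpansion≡∑ n)) (2*∑-subsetCount-1ℙ+1≡3^n n)

blackOn : ∀ {n} → Subset n → Vec Bool n → Bool
blackOn [] [] = false
blackOn (inside ∷ T) (b ∷ c) = b ∨ blackOn T c
blackOn (outside ∷ T) (b ∷ c) = blackOn T c

whiteOn : ∀ {n} → Vec Bool n → Subset n → ℕ
whiteOn c T = if blackOn T c then 0 else 1

whiteColumns : ∀ {n m} → Subset n → Matrix n m → ℕ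
whiteColumns {m = zero} T B = 0
whiteColumns {m = suc m} T B = whiteOn (Vec.map head B) T + whiteColumns T (Vec.map tail B)

orRows-columns : ∀ {n m} (T : Subset n) (B : Matrix n (suc m)) →
  orRows T B ≡ blackOn T (Vec.map head B) ∷ orRows T (Vec.map tail B)
orRows-columns [] [] = refl
orRows-columns (inside ∷ T) ((b ∷ r) ∷ B) rewrite orRows-columns T B = refl
orRows-columns (outside ∷ T) (r ∷ B) = orRows-columns T B

weight-orRows+whiteColumns≡m : ∀ {n m} (T : Subset n) (B : Matrix n m) →
  weight (orRows T B) + whiteColumns T B ≡ m
weight-orRows+whiteColumns≡m {m = zero} T B with orRows T B
... | [] = refl
weight-orRows+whiteColumns≡m {m = suc m} T B
  rewrite orRows-columns T B with blackOn T (Vec.map head B)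
... | true = cong suc (weight-orRows+whiteColumns≡m T (Vec.map tail B))
... | false = trans (+-suc _ _) (cong suc (weight-orRows+whiteColumns≡m T (Vec.map tail B)))

weight-replicate-false : ∀ m → weight (replicate m false) ≡ 0
weight-replicate-false zero = refl
weight-replicate-false (suc m) = weight-replicate-false m

weight-orRows-Empty : ∀ {n m} {T : Subset n} (B : Matrix n m) → Empty T → weight (orRows T B) ≡ 0
weight-orRows-Empty {m = m} {[]} [] _ = weight-replicate-false m
weight-orRows-Empty {T = inside ∷ T} (r ∷ B) T-empty = contradiction (zero , here) T-empty
weight-orRows-Empty {T = outside ∷ T} (r ∷ B) T-empty = weight-orRows-Empty B (drop-∷-Empty T-empty)

-- The sets T ⊇ W on which c is white form an interval [W, Z] (Z the white
-- rows), so the alternating count is 1 if W = Z and 0 otherwise.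
supersetSum-whiteOn : ∀ {n} (c : Vec Bool n) (W : Subset n) →
  supersetSum 1ℙ (whiteOn c) W ≤ supersetSum 0ℙ (whiteOn c) W
supersetSum-whiteOn [] [] = z≤n
supersetSum-whiteOn (false ∷ c) (inside ∷ W) = supersetSum-whiteOn c W
supersetSum-whiteOn (true ∷ c) (inside ∷ W) = ≤-trans (≤-reflexive (supersetSum-0 1ℙ W)) z≤n
supersetSum-whiteOn (false ∷ c) (outside ∷ W) =
  ≤-reflexive (+-comm (supersetSum 1ℙ (whiteOn c) W) _)
supersetSum-whiteOn (true ∷ c) (outside ∷ W) = +-mono-≤
  (supersetSum-whiteOn c W)
  (≤-reflexive (trans (supersetSum-0 0ℙ W) (sym (supersetSum-0 1ℙ W))))

supersetSum-whiteColumns : ∀ {n m} (B : Matrix n m) (W : Subset n) →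
  supersetSum 1ℙ (λ T → whiteColumns T B) W ≤ supersetSum 0ℙ (λ T → whiteColumns T B) W
supersetSum-whiteColumns {m = zero} B W =
  ≤-reflexive (trans (supersetSum-0 1ℙ W) (sym (supersetSum-0 0ℙ W)))
supersetSum-whiteColumns {m = suc m} B W = subst₂ _≤_
  (sym (supersetSum-distrib-+ 1ℙ W _ _))
  (sym (supersetSum-distrib-+ 0ℙ W _ _))
  (+-mono-≤ (supersetSum-whiteOn (Vec.map head B) W)
            (supersetSum-whiteColumns (Vec.map tail B) W))

≢[]⇒∃∈ : ∀ {A : Set} {xs : List A} → xs ≢ [] → ∃ (_∈ xs)
≢[]⇒∃∈ {xs = []} xs≢[] = contradiction refl xs≢[]
≢[]⇒∃∈ {xs = x ∷ xs} _ = x , Any.here refl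

module _ {n m : ℕ} (S : EVCS n m)
         (positive : ∀ T → Nonempty T → SEVCS.l S T < SEVCS.h S T) where

  open SEVCS S

  level : Bool → Subset n → ℕ
  level black T with nonempty? T
  ... | yes _ = if black then h T else l T
  ... | no _ = 0

  level-⊥ : ∀ black → level black ⊥ ≡ 0
  level-⊥ black with nonempty? (⊥ {n})
  ... | yes (_ , x∈⊥) = contradiction x∈⊥ ∉⊥
  ... | no _ = refl

  weight-orRows≡level : ∀ 𝔗 B → B ∈ C 𝔗 → ∀ T → weight (orRows T B) ≡ level (𝔗 T) T
  weight-orRows≡level 𝔗 B B∈C T with nonempty? T
  ... | yes T-nonempty = contrast 𝔗 B B∈C T T-nonempty
  ... | no T-empty = weight-orRows-Empty B T-empty

  supersetSum-levels : ∀ W →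
    supersetSum 1ℙ (λ T → m ∸ level false T) W ≤ supersetSum 0ℙ (λ T → m ∸ level true T) W
  supersetSum-levels W = subst₂ _≤_
    (supersetSum-cong 1ℙ W (λ T T⊇W → whiteColumns≡ T (⊇ᵇ-⁻¹-disjoint 1ℙ T W T⊇W)))
    (supersetSum-cong 0ℙ W whiteColumns≡)
    (supersetSum-whiteColumns B W)
    where
    𝔗 : Family n
    𝔗 T = T ⊇[ 0ℙ ]ᵇ W
    B : Matrix n m
    B = proj₁ (≢[]⇒∃∈ (C-nonempty 𝔗))
    B∈C𝔗 : B ∈ C 𝔗
    B∈C𝔗 = proj₂ (≢[]⇒∃∈ (C-nonempty 𝔗))
    whiteColumns≡ : ∀ {black} T → 𝔗 T ≡ black → whiteColumns T B ≡ m ∸ level black T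
    whiteColumns≡ T refl = begin
      whiteColumns T B
        ≡⟨ sym (m+n∸m≡n (weight (orRows T B)) _) ⟩
      weight (orRows T B) + whiteColumns T B ∸ weight (orRows T B)
        ≡⟨ cong₂ _∸_ (weight-orRows+whiteColumns≡m T B)
                     (weight-orRows≡level 𝔗 B B∈C𝔗 T) ⟩
      m ∸ level (𝔗 T) T ∎
      where open ≡-Reasoning

  drosteExpansion≤m : drosteExpansion n ≤ m
  drosteExpansion≤m = +-cancelʳ-≤ (∑ (λ T → c₁ T * X T)) _ m (begin
    drosteExpansion n + ∑ (λ T → c₁ T * X T)
      ≡⟨ cong (_+ ∑ (λ T → c₁ T * X T)) (drosteExpansion≡∑ n) ⟩
    ∑ c₁ + ∑ (λ T → c₁ T * X T)      ≡⟨ ∑-distrib-+ c₁ _ ⟨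
    ∑ (λ T → c₁ T + c₁ T * X T)      ≤⟨ ∑-mono-≤ gap ⟩
    ∑ (λ T → c₁ T * Y T)             ≡⟨ ∑-supersetSum 1ℙ Y ⟨
    ∑ (supersetSum 1ℙ Y)             ≤⟨ ∑-mono-≤ supersetSum-levels ⟩
    ∑ (supersetSum 0ℙ X)             ≡⟨ ∑-supersetSum 0ℙ X ⟩
    ∑ (λ T → subsetCount 0ℙ T * X T) ≡⟨ ∑-subsetCount-alternating X ⟩
    X ⊥ + ∑ (λ T → c₁ T * X T)       ≡⟨ cong (λ x → m ∸ x + ∑ (λ T → c₁ T * X T)) (level-⊥ true) ⟩
    m + ∑ (λ T → c₁ T * X T)         ∎)
    where
    open ≤-Reasoning
    c₁ X Y : Subset n → ℕ
    c₁ = subsetCount 1ℙ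
    X T = m ∸ level true T
    Y T = m ∸ level false T
    gap : ∀ T → c₁ T + c₁ T * X T ≤ c₁ T * Y T
    gap T with nonempty? T
    ... | yes T-nonempty = begin
      c₁ T + c₁ T * (m ∸ h T)  ≡⟨ *-suc (c₁ T) _ ⟨
      c₁ T * suc (m ∸ h T)     ≤⟨ *-monoʳ-≤ (c₁ T) (∸-monoʳ-< (positive T T-nonempty) (h≤m T T-nonempty)) ⟩
      c₁ T * (m ∸ l T)         ∎
    ... | no T-empty rewrite subsetCount-1ℙ-Empty T-empty = z≤n

mainTheorem3 : ∀ (n : ℕ) → 1 ≤ n →
    (∀ (m : ℕ) (S : EVCS n m) →
    (∀ T → Nonempty T → SEVCS.l S T < SEVCS.h S T) →
    3 ^ n ≤ 2 * m + 1)
    × (2 * drosteExpansion n + 1 ≡ 3 ^ n)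
mainTheorem3 n _ = lowerBound , 2*drosteExpansion+1≡3^n n
  where
  open ≤-Reasoning
  lowerBound : ∀ m (S : EVCS n m) → (∀ T → Nonempty T → SEVCS.l S T < SEVCS.h S T) →
    3 ^ n ≤ 2 * m + 1
  lowerBound m S positive = begin
    3 ^ n                        ≡⟨ 2*drosteExpansion+1≡3^n n ⟨
    2 * drosteExpansion n + 1    ≤⟨ +-monoˡ-≤ 1 (*-monoʳ-≤ 2 (drosteExpansion≤m S positive)) ⟩
    2 * m + 1                    ∎
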